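{- Let $a,h,d,k$ be positive integers with $\gcd(a,d)=1$, $a>2$ and $2\leq 2k\leq a-1$, and let $A=(a,\ ha+d,\ ha+2d,\ ha+4d,\ \dots,\ ha+2kd)$. (i) If $a$ is even, write $a-1=2ks+t$ with $1\leq t\leq 2k$; then $$g(A)=\begin{cases} ha\big(\lfloor \frac{a-2}{2k}\rfloor +2\big)+(a-1)d-a & \text{if } t\neq 1,\\[2pt] ha\big( \frac{a-2}{2k} +1\big)+(a-1)d-a & \text{if } t=1.\end{cases}$$ (ii) If $a$ is odd, write $a-2=2ks+t$ with $1\leq t\leq 2k$; then $$g(A)=\begin{cases} \max\Big\{ha\big(\lfloor \frac{a-2}{2k}\rfloor +1\big)+(a-1)d-a,\ ha\big(\lfloor \frac{a-3}{2k}\rfloor +2\big)+(a-2)d-a\Big\} & \text{if } t\neq 1,\\[2pt] ha\big(\lfloor \frac{a-2}{2k}\rfloor +1\big)+(a-1)d-a & \text{if } t=1.\end{cases}$$ (iii) With $s=\lfloor \frac{a-2}{2k}\rfloor$ and $t=a-1-2k\lfloor \frac{a-2}{2k}\rfloor$, $$n(A)=h(s^2k+st-s-1)+(a-1)\Big(h+\frac{d}{2}-\frac{1}{2}\Big)+h\Big\lceil \frac{t}{2}\Big\rceil.$$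
   Context: For a vector $A=(a_1,\dots,a_n)$ of positive integers with $\gcd(A)=1$, an integer $a_0\geq 0$ is representable by $A$ if $a_0=\sum_i a_ix_i$ for some $x_i\in\mathbb{N}=\{0,1,2,\dots\}$. Let $\mathcal{NR}(A)$ be the (finite) set of nonnegative integers not representable by $A$. The Frobenius number is $g(A)=\max\mathcal{NR}(A)$ and the Sylvester number is $n(A)=\#\mathcal{NR}(A)$. -}

module Defs where

open import Data.Nat using (ℕ; zero; suc; _+_; _*_; _∸_; _<_; _/_)
open import Data.List using (List; []; _∷_; map; length; upTo)
open import Data.List.Membership.Propositional using (_∈_)
open import Data.List.Relation.Unary.Unique.Propositional using (Unique)
open import Data.Product using (Σ; _×_)
open import Relation.Binary.PropositionalEquality using (_≡_)
open import Relation.Nullary using (¬_)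
open import Function.Bundles using (_⇔_)

Representable : List ℕ → ℕ → Set
Representable []       n = n ≡ 0
Representable (x ∷ xs) n = Σ ℕ λ c → Σ ℕ λ m → (n ≡ c * x + m) × Representable xs m

IsFrobenius : List ℕ → ℕ → Set
IsFrobenius A g = ¬ Representable A g × (∀ m → g < m → Representable A m)

IsSylvester : List ℕ → ℕ → Set
IsSylvester A N =
  Σ (List ℕ) λ L → Unique L × (∀ m → (m ∈ L) ⇔ (¬ Representable A m)) × (length L ≡ N)

-- floor division, used only with a positive divisor
fdiv : ℕ → ℕ → ℕ
fdiv m zero    = 0
fdiv m (suc n) = m / suc n

ceilHalf : ℕ → ℕ
ceilHalf t = (t + 1) / 2

vecA : ℕ → ℕ → ℕ → ℕ → List ℕ
vecA a h d k = a ∷ (h * a + d) ∷ map (λ j → h * a + 2 * (suc j) * d) (upTo k)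

{-# OPTIONS --safe #-}
-- Put H = h·a. An element of ⟨A⟩ is a multiple of a plus n generators H + j·d with j ∈ {1, 2, 4, …, 2k};
-- modulo a only n and the total d-coefficient y matter, and the least n achieving y is
-- μ(y) = ⌈⌊y/2⌋/k⌉ + (y mod 2). Hence W(y) = μ(y)·H + y·d is the least element of ⟨A⟩ congruent to y·d,
-- and as gcd(a, d) = 1 the values W(0), …, W(a − 1) form the Apéry set of a: the gaps are the numbers
-- W(y) − j·a with j ≥ 1, so g(A) = max W(y) − a and n(A) = Σ ⌊W(y)/a⌋. Since μ(y) ≤ μ(z) whenever
-- y ≤ z and z is odd, the maximum is attained at a − 1 or at the largest odd y < a. The sum splits as
-- h·Σ μ(y) + Σ ⌊y·d/a⌋; the first is evaluated by induction along y = 2ks + t, and the second equals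
-- (a − 1)(d − 1)/2 by pairing y with a − y.
module Submission where

open import Defs
open import Data.Nat using (ℕ; _≤_; _<_; _∸_; zero; suc)
open import Data.Nat using (NonZero; >-nonZero)
open import Data.Nat.Coprimality using (Coprime)
open import Data.Nat.GCD using (gcd)
open import Data.Nat.Divisibility using (_∣_)
open import Data.Product using (Σ; _×_)
open import Relation.Binary.PropositionalEquality using (_≡_; _≢_)
open import Relation.Nullary using (¬_)

module Sums where

  open import Data.Nat
  open import Data.Nat.Properties
  open import Algebra.Properties.CommutativeSemigroup +-commutativeSemigroup using (interchange)
  open import Relation.Binary.PropositionalEquality

  ∑< : ℕ → (ℕ → ℕ) → ℕ
  ∑< zero    f = 0
  ∑< (suc n) f = ∑< n f + f n

  ∑<-cong : ∀ n {f g} → (∀ y → y < n → f y ≡ g y) → ∑< n f ≡ ∑< n g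
  ∑<-cong zero    eq = refl
  ∑<-cong (suc n) eq = cong₂ _+_ (∑<-cong n (λ y y<n → eq y (m<n⇒m<1+n y<n))) (eq n ≤-refl)

  ∑<-distrib-+ : ∀ n f g → ∑< n (λ y → f y + g y) ≡ ∑< n f + ∑< n g
  ∑<-distrib-+ zero    f g = refl
  ∑<-distrib-+ (suc n) f g = trans (cong (_+ (f n + g n)) (∑<-distrib-+ n f g))
                                   (interchange (∑< n f) (∑< n g) (f n) (g n))

  ∑<-*ˡ : ∀ c n f → ∑< n (λ y → c * f y) ≡ c * ∑< n f
  ∑<-*ˡ c zero    f = sym (*-zeroʳ c)
  ∑<-*ˡ c (suc n) f = trans (cong (_+ c * f n) (∑<-*ˡ c n f)) (sym (*-distribˡ-+ c (∑< n f) (f n)))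

  ∑<-const : ∀ n c → ∑< n (λ _ → c) ≡ n * c
  ∑<-const zero    c = refl
  ∑<-const (suc n) c = trans (cong (_+ c) (∑<-const n c)) (+-comm (n * c) c)

  ∑<-suc : ∀ n f → ∑< (suc n) f ≡ f 0 + ∑< n (λ y → f (suc y))
  ∑<-suc zero    f = +-comm 0 (f 0)
  ∑<-suc (suc n) f = trans (cong (_+ f (suc n)) (∑<-suc n f)) (+-assoc (f 0) _ (f (suc n)))

  ∑<-reverse : ∀ n f → ∑< n f ≡ ∑< n (λ y → f (n ∸ suc y))
  ∑<-reverse zero    f = refl
  ∑<-reverse (suc n) f = begin
    ∑< n f + f n                            ≡⟨ +-comm (∑< n f) (f n) ⟩
    f n + ∑< n f                            ≡⟨ cong (f n +_) (∑<-reverse n f) ⟩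
    f n + ∑< n (λ y → f (n ∸ suc y))        ≡⟨ ∑<-suc n (λ y → f (n ∸ y)) ⟨
    ∑< (suc n) (λ y → f (suc n ∸ suc y))    ∎
    where open ≡-Reasoning

  ∑<-pairing : ∀ n f c → (∀ y → y < n → f y + f (n ∸ suc y) ≡ c) → 2 * ∑< n f ≡ n * c
  ∑<-pairing n f c pair = begin
    2 * ∑< n f                                   ≡⟨ cong (∑< n f +_) (+-identityʳ (∑< n f)) ⟩
    ∑< n f + ∑< n f                              ≡⟨ cong (∑< n f +_) (∑<-reverse n f) ⟩
    ∑< n f + ∑< n (λ y → f (n ∸ suc y))          ≡⟨ ∑<-distrib-+ n f (λ y → f (n ∸ suc y)) ⟨
    ∑< n (λ y → f y + f (n ∸ suc y))             ≡⟨ ∑<-cong n pair ⟩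
    ∑< n (λ _ → c)                               ≡⟨ ∑<-const n c ⟩
    n * c                                        ∎
    where open ≡-Reasoning

module Representability where

  open import Data.Nat
  open import Data.List using ([]; _∷_)
  open import Data.List.Membership.Propositional using (_∈_)
  open import Data.List.Relation.Unary.Any using (here; there)
  open import Data.Product using (_,_)
  open import Relation.Binary.PropositionalEquality
  open import Data.Nat.Tactic.RingSolver

  representable-0 : ∀ A → Representable A 0
  representable-0 []       = refl
  representable-0 (x ∷ xs) = 0 , 0 , refl , representable-0 xs

  representable-+* : ∀ {A x} c {n} → x ∈ A → Representable A n → Representable A (c * x + n)
  representable-+* {x ∷ xs} c (here refl) (c₀ , m , refl , r) =
    c + c₀ , m , solve (c ∷ x ∷ c₀ ∷ m ∷ []) , r
  representable-+* {y ∷ xs} {x} c (there x∈) (c₀ , m , refl , r) =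
    c₀ , c * x + m , solve (c ∷ x ∷ c₀ ∷ y ∷ m ∷ []) , representable-+* c x∈ r

module Arithmetic where

  open import Data.Nat
  open import Data.Nat.Properties
  open import Data.Nat.DivMod
  open import Data.Nat.Divisibility using (divides)
  open import Data.Product using (_,_)
  open import Data.Sum using (inj₁; inj₂)
  open import Relation.Nullary using (contradiction)
  open import Relation.Binary.PropositionalEquality

  %-≡⇒≡+* : ∀ {x z} a .{{_ : NonZero a}} → x ≤ z → x % a ≡ z % a → Σ ℕ λ c → z ≡ x + c * a
  %-≡⇒≡+* {x} {z} a x≤z x≡z = z / a ∸ x / a , (begin
    z                                        ≡⟨ m≡m%n+[m/n]*n z a ⟩
    z % a + z / a * a                        ≡⟨ cong₂ (λ r q → r + q * a) x≡z (m+[n∸m]≡n (/-monoˡ-≤ a x≤z)) ⟨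
    x % a + (x / a + (z / a ∸ x / a)) * a    ≡⟨ cong (x % a +_) (*-distribʳ-+ a (x / a) _) ⟩
    x % a + (x / a * a + (z / a ∸ x / a) * a) ≡⟨ +-assoc (x % a) _ _ ⟨
    x % a + x / a * a + (z / a ∸ x / a) * a  ≡⟨ cong (_+ (z / a ∸ x / a) * a) (m≡m%n+[m/n]*n x a) ⟨
    x + (z / a ∸ x / a) * a                  ∎)
    where open ≡-Reasoning

  %-≡∧<+⇒≤ : ∀ {x z} a .{{_ : NonZero a}} → x % a ≡ z % a → x < z + a → x ≤ z
  %-≡∧<+⇒≤ {x} {z} a x≡z x<z+a with ≤-total x z
  ... | inj₁ x≤z = x≤z
  ... | inj₂ z≤x with %-≡⇒≡+* a z≤x (sym x≡z)
  ...   | zero  , x≡z+0 = ≤-reflexive (trans x≡z+0 (+-identityʳ z))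
  ...   | suc c , refl  = contradiction (+-monoʳ-≤ z (m≤m+n a (c * a))) (<⇒≱ x<z+a)

  [r+q*n]/n≡q : ∀ {r} q n .{{_ : NonZero n}} → r < n → (r + q * n) / n ≡ q
  [r+q*n]/n≡q {r} q n r<n = begin
    (r + q * n) / n    ≡⟨ +-distrib-/-∣ʳ r (divides q refl) ⟩
    r / n + q * n / n  ≡⟨ cong₂ _+_ (m<n⇒m/n≡0 r<n) (m*n/n≡m q n) ⟩
    q                  ∎
    where open ≡-Reasoning

  m∸n≡1+m∸[1+n] : ∀ {m n} → n < m → m ∸ n ≡ suc (m ∸ suc n)
  m∸n≡1+m∸[1+n] {suc m} (s≤s n≤m) = +-∸-assoc 1 n≤m

  2*k<a⇒2<a : ∀ {k a} .{{_ : NonZero k}} → 2 * k < a → 2 < a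
  2*k<a⇒2<a {k} 2k<a = ≤-<-trans (*-monoʳ-≤ 2 (>-nonZero⁻¹ k)) 2k<a

  fdiv≡/ : ∀ m n .{{_ : NonZero n}} → fdiv m n ≡ m / n
  fdiv≡/ m (suc n) = refl

  %-cong-* : ∀ {x x′ y y′} a .{{_ : NonZero a}} → x % a ≡ x′ % a → y % a ≡ y′ % a → (x * y) % a ≡ (x′ * y′) % a
  %-cong-* {x} {x′} {y} {y′} a x≡x′ y≡y′ = begin
    (x * y) % a                 ≡⟨ %-distribˡ-* x y a ⟩
    ((x % a) * (y % a)) % a     ≡⟨ cong₂ (λ u v → (u * v) % a) x≡x′ y≡y′ ⟩
    ((x′ % a) * (y′ % a)) % a   ≡⟨ %-distribˡ-* x′ y′ a ⟨
    (x′ * y′) % a               ∎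
    where open ≡-Reasoning

module AperySet where

  open import Data.Nat
  open import Data.Nat.Properties
  open import Data.Nat.DivMod
  open import Data.Product using (_,_; proj₁; proj₂)
  open import Data.Sum using (inj₁; inj₂)
  open import Data.List using (List; []; _++_; map; upTo; length)
  open import Data.List.Properties using (length-++; length-map; length-upTo)
  open import Data.List.Membership.Propositional using (_∈_)
  open import Data.List.Membership.Propositional.Properties
    using (∈-map⁺; ∈-map⁻; ∈-upTo⁺; ∈-upTo⁻; ∈-++⁺ˡ; ∈-++⁺ʳ; ∈-++⁻)
  open import Data.List.Relation.Unary.Unique.Propositional using (Unique)
  import Data.List.Relation.Unary.Unique.Propositional.Properties as Unique
  open import Data.List.Relation.Unary.AllPairs using ([])
  open import Function using (_∘_)
  open import Function.Bundles using (_⇔_; mk⇔; Equivalence)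
  open import Relation.Binary.PropositionalEquality
  open Sums using (∑<)
  open Arithmetic

  record IsAperyEnumeration (A : List ℕ) (a : ℕ) {{_ : NonZero a}} (W : ℕ → ℕ) : Set where
    field
      representable      : ∀ y c → y < a → Representable A (W y + c * a)
      minimal            : ∀ {n} → Representable A n → Σ ℕ λ y → Σ ℕ λ c → y < a × n ≡ W y + c * a
      residue-injective  : ∀ {y y′} → y < a → y′ < a → W y % a ≡ W y′ % a → y ≡ y′
      residue-surjective : ∀ m → Σ ℕ λ y → y < a × W y % a ≡ m % a

  module _ {A : List ℕ} {a : ℕ} {{_ : NonZero a}} {W : ℕ → ℕ} (apery : IsAperyEnumeration A a W) where

    open IsAperyEnumeration apery

    representable⇔W≤ : ∀ {y m} → y < a → W y % a ≡ m % a → Representable A m ⇔ W y ≤ m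
    representable⇔W≤ {y} {m} y<a Wy≡m = mk⇔ to from
      where
      to : Representable A m → W y ≤ m
      to r with minimal r
      ... | y′ , c , y′<a , refl = subst (λ z → W z ≤ W y′ + c * a) y′≡y (m≤m+n (W y′) (c * a))
        where
        y′≡y : y′ ≡ y
        y′≡y = residue-injective y′<a y<a (sym (trans Wy≡m ([m+kn]%n≡m%n (W y′) c a)))
      from : W y ≤ m → Representable A m
      from Wy≤m with %-≡⇒≡+* a Wy≤m Wy≡m
      ... | c , refl = representable y c y<a

    isFrobenius : ∀ {M} → (Σ ℕ λ y → y < a × W y ≡ M) → (∀ y → y < a → W y ≤ M) → a ≤ M →
                  IsFrobenius A (M ∸ a)
    isFrobenius {M} (y₀ , y₀<a , refl) max a≤M = gap , beyond
      where
      g+a≡M : M ∸ a + a ≡ M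
      g+a≡M = m∸n+n≡m a≤M
      gap : ¬ Representable A (M ∸ a)
      gap r = <⇒≱ (subst (M ∸ a <_) g+a≡M (m<m+n (M ∸ a) (>-nonZero⁻¹ a)))
                  (Equivalence.to (representable⇔W≤ y₀<a W≡g) r)
        where
        W≡g : W y₀ % a ≡ (M ∸ a) % a
        W≡g = trans (cong (_% a) (sym g+a≡M)) ([m+n]%n≡m%n (M ∸ a) a)
      beyond : ∀ m → M ∸ a < m → Representable A m
      beyond m g<m with residue-surjective m
      ... | y , y<a , Wy≡m = Equivalence.from (representable⇔W≤ y<a Wy≡m)
            (%-≡∧<+⇒≤ a Wy≡m (≤-<-trans (max y y<a) (subst (_< m + a) g+a≡M (+-monoˡ-< a g<m))))

    gapsBelow : ℕ → List ℕ
    gapsBelow y = map (λ j → W y % a + j * a) (upTo (W y / a))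

    ∈-gapsBelow⁻ : ∀ {m y} → m ∈ gapsBelow y → m % a ≡ W y % a × m < W y
    ∈-gapsBelow⁻ {m} {y} m∈ with ∈-map⁻ (λ j → W y % a + j * a) m∈
    ... | j , j∈ , refl = trans ([m+kn]%n≡m%n (W y % a) j a) (m%n%n≡m%n (W y) a)
                        , subst (W y % a + j * a <_) (sym (m≡m%n+[m/n]*n (W y) a))
                                (+-monoʳ-< (W y % a) (*-monoˡ-< a (∈-upTo⁻ j∈)))

    ∈-gapsBelow⁺ : ∀ {m y} → m % a ≡ W y % a → m < W y → m ∈ gapsBelow y
    ∈-gapsBelow⁺ {m} {y} m≡W m<W = subst (_∈ gapsBelow y) (sym m≡r+qa) (∈-map⁺ _ (∈-upTo⁺ q<Q))
      where
      m≡r+qa : m ≡ W y % a + m / a * a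
      m≡r+qa = trans (m≡m%n+[m/n]*n m a) (cong (_+ m / a * a) m≡W)
      q<Q : m / a < W y / a
      q<Q = *-cancelʳ-< _ (m / a) (W y / a) (+-cancelˡ-< (W y % a) _ _
              (subst₂ _<_ m≡r+qa (m≡m%n+[m/n]*n (W y) a) m<W))

    gapsBelow-unique : ∀ y → Unique (gapsBelow y)
    gapsBelow-unique y = Unique.map⁺ (λ {i} {j} eq → *-cancelʳ-≡ i j a (+-cancelˡ-≡ (W y % a) _ _ eq))
                                     (Unique.upTo⁺ (W y / a))

    gaps : ℕ → List ℕ
    gaps zero    = []
    gaps (suc n) = gaps n ++ gapsBelow n

    ∈-gaps⁻ : ∀ {m} n → m ∈ gaps n → Σ ℕ λ y → y < n × m ∈ gapsBelow y
    ∈-gaps⁻ (suc n) m∈ with ∈-++⁻ (gaps n) m∈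
    ... | inj₂ m∈n = n , ≤-refl , m∈n
    ... | inj₁ m∈< with ∈-gaps⁻ n m∈<
    ...   | y , y<n , m∈y = y , m<n⇒m<1+n y<n , m∈y

    ∈-gaps⁺ : ∀ {m y} n → y < n → m ∈ gapsBelow y → m ∈ gaps n
    ∈-gaps⁺ (suc n) y<1+n m∈y with m≤n⇒m<n∨m≡n (s≤s⁻¹ y<1+n)
    ... | inj₁ y<n  = ∈-++⁺ˡ (∈-gaps⁺ n y<n m∈y)
    ... | inj₂ refl = ∈-++⁺ʳ (gaps n) m∈y

    gaps-unique : ∀ n → n ≤ a → Unique (gaps n)
    gaps-unique zero    _   = []
    gaps-unique (suc n) n<a = Unique.++⁺ (gaps-unique n (<⇒≤ n<a)) (gapsBelow-unique n) disjoint
      where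
      disjoint : ∀ {m} → ¬ (m ∈ gaps n × m ∈ gapsBelow n)
      disjoint (m∈< , m∈n) with ∈-gaps⁻ n m∈<
      ... | y , y<n , m∈y = <⇒≢ y<n (residue-injective (<-trans y<n n<a) n<a
              (trans (sym (proj₁ (∈-gapsBelow⁻ m∈y))) (proj₁ (∈-gapsBelow⁻ m∈n))))

    length-gaps : ∀ n → length (gaps n) ≡ ∑< n (λ y → W y / a)
    length-gaps zero    = refl
    length-gaps (suc n) = trans (length-++ (gaps n))
      (cong₂ _+_ (length-gaps n) (trans (length-map _ (upTo (W n / a))) (length-upTo (W n / a))))

    ∈-gaps⇔ : ∀ m → (m ∈ gaps a) ⇔ (¬ Representable A m)
    ∈-gaps⇔ m = mk⇔ to from
      where
      to : m ∈ gaps a → ¬ Representable A m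
      to m∈ with ∈-gaps⁻ a m∈
      ... | y , y<a , m∈y = <⇒≱ (proj₂ (∈-gapsBelow⁻ m∈y))
                              ∘ Equivalence.to (representable⇔W≤ y<a (sym (proj₁ (∈-gapsBelow⁻ m∈y))))
      from : ¬ Representable A m → m ∈ gaps a
      from m∉ with residue-surjective m
      ... | y , y<a , Wy≡m = ∈-gaps⁺ a y<a (∈-gapsBelow⁺ (sym Wy≡m)
              (≰⇒> (m∉ ∘ Equivalence.from (representable⇔W≤ y<a Wy≡m))))

    isSylvester : IsSylvester A (∑< a (λ y → W y / a))
    isSylvester = gaps a , gaps-unique a ≤-refl , ∈-gaps⇔ , length-gaps a

module Residues where

  open import Data.Nat
  open import Data.Nat.Properties
  open import Data.Nat.DivMod
  open import Data.Nat.Divisibility using (divides; ∣⇒≤)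
  open import Data.Nat.Coprimality using (Coprime; coprime-divisor; coprime-Bézout)
  open import Data.Nat.GCD using (module Bézout)
  open import Data.Product using (_,_)
  open import Data.Sum using (inj₁; inj₂)
  open import Relation.Nullary using (contradiction)
  open import Relation.Binary.PropositionalEquality
  open import Data.Nat.Tactic.RingSolver
  open Sums
  open Arithmetic

  module _ {a d : ℕ} {{_ : NonZero a}} (a⊥d : Coprime a d) where

    *-%≡0⇒≡0 : ∀ {y} → y < a → (y * d) % a ≡ 0 → y ≡ 0
    *-%≡0⇒≡0 {zero}  _   _      = refl
    *-%≡0⇒≡0 {suc y} y<a yd%a≡0 = contradiction (∣⇒≤ a∣y) (<⇒≱ y<a)
      where
      a∣y = coprime-divisor a⊥d (divides (suc y * d / a)
              (trans (*-comm d (suc y)) (trans (m≡m%n+[m/n]*n (suc y * d) a) (cong (_+ suc y * d / a * a) yd%a≡0))))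

    *-%-injective-≤ : ∀ {y y′} → y ≤ y′ → y′ < a → (y * d) % a ≡ (y′ * d) % a → y ≡ y′
    *-%-injective-≤ {y} {y′} y≤y′ y′<a yd≡y′d with %-≡⇒≡+* a (*-monoˡ-≤ d y≤y′) yd≡y′d
    ... | c , y′d≡yd+ca = trans (sym (+-identityʳ y)) (trans (cong (y +_) (sym δ≡0)) (m+[n∸m]≡n y≤y′))
      where
      δ = y′ ∸ y
      δd≡ca : δ * d ≡ c * a
      δd≡ca = +-cancelˡ-≡ (y * d) _ _ (begin
        y * d + δ * d ≡⟨ *-distribʳ-+ d y δ ⟨
        (y + δ) * d   ≡⟨ cong (_* d) (m+[n∸m]≡n y≤y′) ⟩
        y′ * d        ≡⟨ y′d≡yd+ca ⟩
        y * d + c * a ∎)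
        where open ≡-Reasoning
      δ≡0 : δ ≡ 0
      δ≡0 = *-%≡0⇒≡0 (≤-<-trans (m∸n≤m y′ y) y′<a) (trans (cong (_% a) δd≡ca) (m*n%n≡0 c a))

    *-%-injective : ∀ {y y′} → y < a → y′ < a → (y * d) % a ≡ (y′ * d) % a → y ≡ y′
    *-%-injective {y} {y′} y<a y′<a eq with ≤-total y y′
    ... | inj₁ y≤y′ = *-%-injective-≤ y≤y′ y′<a eq
    ... | inj₂ y′≤y = sym (*-%-injective-≤ y′≤y y<a (sym eq))

    modular-inverse : Σ ℕ λ v → (v * d) % a ≡ 1 % a
    modular-inverse with coprime-Bézout a⊥d
    ... | Bézout.-+ x y 1+xa≡yd = y , trans (cong (_% a) (sym 1+xa≡yd)) ([m+kn]%n≡m%n 1 x a)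
    ... | Bézout.+- x y 1+yd≡xa = y * p , (begin   -- y·d ≡ −1, so y·(a − 1)·d ≡ 1
      (y * p * d) % a         ≡⟨ [m+n]%n≡m%n (y * p * d) a ⟨
      (y * p * d + a) % a     ≡⟨ cong (_% a) ypd+a≡1+pxa ⟩
      (1 + p * x * a) % a     ≡⟨ [m+kn]%n≡m%n 1 (p * x) a ⟩
      1 % a                   ∎)
      where
      open ≡-Reasoning
      p = pred a
      ypd+a≡1+pxa : y * p * d + a ≡ 1 + p * x * a
      ypd+a≡1+pxa = begin
        y * p * d + a           ≡⟨ cong (y * p * d +_) (suc-pred a) ⟨
        y * p * d + suc p       ≡⟨ distribute y p d ⟩
        1 + p * (1 + y * d)     ≡⟨ cong (λ z → 1 + p * z) 1+yd≡xa ⟩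
        1 + p * (x * a)         ≡⟨ cong (1 +_) (*-assoc p x a) ⟨
        1 + p * x * a           ∎
        where
        distribute : ∀ y p d → y * p * d + suc p ≡ 1 + p * (1 + y * d)
        distribute = solve-∀

    *-%-surjective : ∀ m → Σ ℕ λ y → y < a × (y * d) % a ≡ m % a
    *-%-surjective m with modular-inverse
    ... | v , vd≡1 = (m * v) % a , m%n<n (m * v) a , (begin
      ((m * v) % a * d) % a   ≡⟨ %-cong-* a (m%n%n≡m%n (m * v) a) refl ⟩
      (m * v * d) % a         ≡⟨ cong (_% a) (*-assoc m v d) ⟩
      (m * (v * d)) % a       ≡⟨ %-cong-* {m} a refl vd≡1 ⟩
      (m * 1) % a             ≡⟨ cong (_% a) (*-identityʳ m) ⟩
      m % a                   ∎)
      where open ≡-Reasoning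

    -- The remainders of y·d and (a − y)·d are nonzero and add up to a multiple of a below 2a.
    ⌊yd/a⌋+⌊[a∸y]d/a⌋≡d∸1 : ∀ {y} → 0 < y → y < a → y * d / a + (a ∸ y) * d / a ≡ d ∸ 1
    ⌊yd/a⌋+⌊[a∸y]d/a⌋≡d∸1 {y} 0<y y<a = cong pred (≤-antisym G<d (s≤s⁻¹ d<2+G))
      where
      r₁ = (y * d) % a
      r₂ = ((a ∸ y) * d) % a
      G = y * d / a + (a ∸ y) * d / a
      R = r₁ + r₂
      da≡R+Ga : d * a ≡ R + G * a
      da≡R+Ga = begin
        d * a                                            ≡⟨ *-comm d a ⟩
        a * d                                            ≡⟨ cong (_* d) (m+[n∸m]≡n (<⇒≤ y<a)) ⟨
        (y + (a ∸ y)) * d                                ≡⟨ *-distribʳ-+ d y (a ∸ y) ⟩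
        y * d + (a ∸ y) * d
          ≡⟨ cong₂ _+_ (m≡m%n+[m/n]*n (y * d) a) (m≡m%n+[m/n]*n ((a ∸ y) * d) a) ⟩
        r₁ + y * d / a * a + (r₂ + (a ∸ y) * d / a * a)  ≡⟨ regroup r₁ (y * d / a) r₂ ((a ∸ y) * d / a) a ⟩
        R + G * a                                        ∎
        where
        open ≡-Reasoning
        regroup : ∀ r₁ q₁ r₂ q₂ a → r₁ + q₁ * a + (r₂ + q₂ * a) ≡ (r₁ + r₂) + (q₁ + q₂) * a
        regroup = solve-∀
      0<R : 0 < R
      0<R = ≤-trans (n≢0⇒n>0 (λ r₁≡0 → <⇒≢ 0<y (sym (*-%≡0⇒≡0 y<a r₁≡0)))) (m≤m+n r₁ r₂)
      G<d : G < d
      G<d = *-cancelʳ-< a G d (subst (G * a <_) (sym da≡R+Ga) (m<n+m (G * a) 0<R))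
      d<2+G : d < 2 + G
      d<2+G = *-cancelʳ-< a d (2 + G) (begin-strict
        d * a          ≡⟨ da≡R+Ga ⟩
        R + G * a      <⟨ +-monoˡ-< (G * a) (+-mono-< (m%n<n (y * d) a) (m%n<n ((a ∸ y) * d) a)) ⟩
        a + a + G * a  ≡⟨ cong (λ z → a + z + G * a) (+-identityʳ a) ⟨
        2 * a + G * a  ≡⟨ *-distribʳ-+ a 2 G ⟨
        (2 + G) * a    ∎)
        where open ≤-Reasoning

  ∑⌊yd/a⌋ : ∀ {a d} {{_ : NonZero a}} → Coprime a d → 2 * ∑< a (λ y → y * d / a) ≡ (a ∸ 1) * (d ∸ 1)
  ∑⌊yd/a⌋ {suc n} {d} a⊥d = begin
    2 * ∑< (suc n) F                  ≡⟨ cong (2 *_) (∑<-suc n F) ⟩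
    2 * (F 0 + ∑< n (λ y → F (suc y))) ≡⟨ cong (λ z → 2 * (z + ∑< n (λ y → F (suc y)))) (0/n≡0 (suc n)) ⟩
    2 * ∑< n (λ y → F (suc y))         ≡⟨ ∑<-pairing n (λ y → F (suc y)) (d ∸ 1) pair ⟩
    n * (d ∸ 1)                        ∎
    where
    open ≡-Reasoning
    F : ℕ → ℕ
    F y = y * d / suc n
    pair : ∀ y → y < n → F (suc y) + F (suc (n ∸ suc y)) ≡ d ∸ 1
    pair y y<n = trans (cong (λ z → F (suc y) + F z) (sym (+-∸-assoc 1 y<n)))
                       (⌊yd/a⌋+⌊[a∸y]d/a⌋≡d∸1 a⊥d z<s (s≤s y<n))

module Parity where

  open import Data.Nat
  open import Data.Nat.Properties
  open import Data.Nat.DivMod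
  open import Data.Nat.Divisibility using (_∣_; n∣m⇒m%n≡0)
  open import Relation.Binary.PropositionalEquality

  data EvenOdd : ℕ → Set where
    even : ∀ x → EvenOdd (x * 2)
    odd  : ∀ x → EvenOdd (suc (x * 2))

  evenOdd : ∀ n → EvenOdd n
  evenOdd zero = even 0
  evenOdd (suc n) with evenOdd n
  ... | even x = odd x
  ... | odd x  = even (suc x)

  1+x*2%2≡1 : ∀ x → suc (x * 2) % 2 ≡ 1
  1+x*2%2≡1 x = [m+kn]%n≡m%n 1 x 2

  2∤1+x*2 : ∀ x → ¬ 2 ∣ suc (x * 2)
  2∤1+x*2 x 2∣ = 0≢1+n (trans (sym (n∣m⇒m%n≡0 _ 2 2∣)) (1+x*2%2≡1 x))

  1+x*2≤2*k⇒x<k : ∀ {x k} → suc (x * 2) ≤ 2 * k → x < k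
  1+x*2≤2*k⇒x<k {x} {k} 1+x*2≤2k = *-cancelʳ-< 2 x k (subst (x * 2 <_) (*-comm 2 k) 1+x*2≤2k)

module MinimalLength (k : ℕ) {{_ : NonZero k}} where

  open import Data.Nat
  open import Data.Nat.Properties
  open import Data.Nat.DivMod
  open import Data.Nat.Divisibility using (divides)
  open import Data.Product using (_,_)
  open import Data.Sum using (_⊎_; inj₁; inj₂)
  open import Data.List using ([]; _∷_)
  open import Relation.Binary.PropositionalEquality
  open import Data.Nat.Tactic.RingSolver
  open import Algebra.Properties.CommutativeSemigroup +-commutativeSemigroup using (xy∙z≈xz∙y)
  open Arithmetic
  open Parity
  open Sums using (∑<)
  open import Function using (_∘_)

  instance
    2k≢0 : NonZero (2 * k)
    2k≢0 = m*n≢0 2 k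

  ⌈_/k⌉ : ℕ → ℕ
  ⌈ e /k⌉ = (e + pred k) / k

  pred-k<k : pred k < k
  pred-k<k = subst (pred k <_) (suc-pred k) (n<1+n (pred k))

  ⌈m+q*k/k⌉≡⌈m/k⌉+q : ∀ m q → ⌈ m + q * k /k⌉ ≡ ⌈ m /k⌉ + q
  ⌈m+q*k/k⌉≡⌈m/k⌉+q m q = begin
    (m + q * k + pred k) / k       ≡⟨ cong (_/ k) (xy∙z≈xz∙y m (q * k) (pred k)) ⟩
    (m + pred k + q * k) / k       ≡⟨ +-distrib-/-∣ʳ (m + pred k) (divides q refl) ⟩
    ⌈ m /k⌉ + q * k / k            ≡⟨ cong (⌈ m /k⌉ +_) (m*n/n≡m q k) ⟩
    ⌈ m /k⌉ + q                    ∎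
    where open ≡-Reasoning

  ⌈0/k⌉≡0 : ⌈ 0 /k⌉ ≡ 0
  ⌈0/k⌉≡0 = m<n⇒m/n≡0 pred-k<k

  ⌈1+r/k⌉≡1 : ∀ {r} → r < k → ⌈ suc r /k⌉ ≡ 1
  ⌈1+r/k⌉≡1 {r} r<k = begin
    (suc r + pred k) / k   ≡⟨ cong (_/ k) (+-suc r (pred k)) ⟨
    (r + suc (pred k)) / k ≡⟨ cong (λ z → (r + z) / k) (trans (suc-pred k) (sym (*-identityˡ k))) ⟩
    (r + 1 * k) / k        ≡⟨ [r+q*n]/n≡q 1 k r<k ⟩
    1                      ∎
    where open ≡-Reasoning

  ⌈q*k/k⌉≡q : ∀ q → ⌈ q * k /k⌉ ≡ q
  ⌈q*k/k⌉≡q q = trans (⌈m+q*k/k⌉≡⌈m/k⌉+q 0 q) (cong (_+ q) ⌈0/k⌉≡0)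

  ⌈1+r+q*k/k⌉≡1+q : ∀ {r} q → r < k → ⌈ suc r + q * k /k⌉ ≡ suc q
  ⌈1+r+q*k/k⌉≡1+q {r} q r<k = trans (⌈m+q*k/k⌉≡⌈m/k⌉+q (suc r) q) (cong (_+ q) (⌈1+r/k⌉≡1 r<k))

  ⌈e+k/k⌉≡1+⌈e/k⌉ : ∀ e → ⌈ e + k /k⌉ ≡ suc ⌈ e /k⌉
  ⌈e+k/k⌉≡1+⌈e/k⌉ e = begin
    ⌈ e + k /k⌉      ≡⟨ cong (λ z → ⌈ e + z /k⌉) (*-identityˡ k) ⟨
    ⌈ e + 1 * k /k⌉  ≡⟨ ⌈m+q*k/k⌉≡⌈m/k⌉+q e 1 ⟩
    ⌈ e /k⌉ + 1      ≡⟨ +-comm ⌈ e /k⌉ 1 ⟩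
    suc ⌈ e /k⌉      ∎
    where open ≡-Reasoning

  zero⊎1+r+q*k : ∀ e → e ≡ 0 ⊎ Σ ℕ λ q → Σ ℕ λ r → r < k × e ≡ suc r + q * k
  zero⊎1+r+q*k zero    = inj₁ refl
  zero⊎1+r+q*k (suc e) = inj₂ (e / k , e % k , m%n<n e k , cong suc (m≡m%n+[m/n]*n e k))

  ⌈/k⌉-mono : ∀ {e f} → e ≤ f → ⌈ e /k⌉ ≤ ⌈ f /k⌉
  ⌈/k⌉-mono e≤f = /-monoˡ-≤ k (+-monoˡ-≤ (pred k) e≤f)

  -- The least number of generators h·a + j·d, j ∈ {1, 2, 4, …, 2k}, whose d-coefficients add up to y.
  μ : ℕ → ℕ
  μ y = ⌈ y / 2 /k⌉ + y % 2

  μ-even : ∀ x → μ (x * 2) ≡ ⌈ x /k⌉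
  μ-even x = trans (cong₂ (λ h b → ⌈ h /k⌉ + b) (m*n/n≡m x 2) (m*n%n≡0 x 2)) (+-identityʳ ⌈ x /k⌉)

  μ-odd : ∀ x → μ (suc (x * 2)) ≡ suc ⌈ x /k⌉
  μ-odd x = trans (cong₂ (λ h b → ⌈ h /k⌉ + b) ([r+q*n]/n≡q {1} x 2 (s≤s (s≤s z≤n))) (1+x*2%2≡1 x))
                  (+-comm ⌈ x /k⌉ 1)

  μ-bound : ∀ {y z} → y ≤ z → μ y ≤ ⌈ z / 2 /k⌉ + 1
  μ-bound {y} y≤z = +-mono-≤ (⌈/k⌉-mono (/-monoˡ-≤ 2 y≤z)) (s≤s⁻¹ (m%n<n y 2))

  μ-≤-1+μ : ∀ {y z} → y ≤ z → μ y ≤ suc (μ z)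
  μ-≤-1+μ {z = z} y≤z = ≤-trans (μ-bound y≤z)
    (≤-trans (≤-reflexive (+-comm ⌈ z / 2 /k⌉ 1)) (s≤s (m≤m+n ⌈ z / 2 /k⌉ (z % 2))))

  μ-≤-odd : ∀ {y} x → y ≤ suc (x * 2) → μ y ≤ μ (suc (x * 2))
  μ-≤-odd x y≤z = ≤-trans (μ-bound y≤z) (≤-reflexive (cong (⌈ suc (x * 2) / 2 /k⌉ +_) (sym (1+x*2%2≡1 x))))

  μ-+k*2 : ∀ y → μ (y + k * 2) ≡ suc (μ y)
  μ-+k*2 y = begin
    ⌈ (y + k * 2) / 2 /k⌉ + (y + k * 2) % 2  ≡⟨ cong₂ (λ h b → ⌈ h /k⌉ + b) half ([m+kn]%n≡m%n y k 2) ⟩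
    ⌈ y / 2 + k /k⌉ + y % 2                  ≡⟨ cong (_+ y % 2) (⌈e+k/k⌉≡1+⌈e/k⌉ (y / 2)) ⟩
    suc (μ y)                                ∎
    where
    open ≡-Reasoning
    half : (y + k * 2) / 2 ≡ y / 2 + k
    half = trans (+-distrib-/-∣ʳ y (divides k refl)) (cong (y / 2 +_) (m*n/n≡m k 2))

  μ-mono-+k*2 : ∀ {y z} → y + k * 2 ≤ z → μ y ≤ μ z
  μ-mono-+k*2 {y} {z} y+2k≤z = s≤s⁻¹ (subst (_≤ suc (μ z)) (μ-+k*2 y) (μ-≤-1+μ y+2k≤z))

  μ-suc : ∀ y → μ (suc y) ≤ suc (μ y)
  μ-suc y with evenOdd y
  ... | even x = ≤-reflexive (trans (μ-odd x) (cong suc (sym (μ-even x))))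
  ... | odd x  = begin
    μ (suc x * 2)        ≡⟨ μ-even (suc x) ⟩
    ⌈ suc x /k⌉          ≤⟨ ⌈/k⌉-mono (subst (suc x ≤_) (+-comm k x) (+-monoˡ-≤ x (>-nonZero⁻¹ k))) ⟩
    ⌈ x + k /k⌉          ≡⟨ ⌈e+k/k⌉≡1+⌈e/k⌉ x ⟩
    suc ⌈ x /k⌉          ≡⟨ μ-odd x ⟨
    μ (suc (x * 2))      ≤⟨ n≤1+n _ ⟩
    suc (μ (suc (x * 2))) ∎
    where open ≤-Reasoning

  μ-+ : ∀ x y → μ (x + y) ≤ x + μ y
  μ-+ zero    y = ≤-refl
  μ-+ (suc x) y = ≤-trans (μ-suc (x + y)) (s≤s (μ-+ x y))

  2*k*s+u*2≡[u+s*k]*2 : ∀ s u → 2 * k * s + u * 2 ≡ (u + s * k) * 2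
  2*k*s+u*2≡[u+s*k]*2 s u = solve (s ∷ u ∷ k ∷ [])

  2*k*s+1+u*2≡1+[u+s*k]*2 : ∀ s u → 2 * k * s + suc (u * 2) ≡ suc ((u + s * k) * 2)
  2*k*s+1+u*2≡1+[u+s*k]*2 s u = trans (+-suc (2 * k * s) (u * 2)) (cong suc (2*k*s+u*2≡[u+s*k]*2 s u))

  [u+s*k]*2≡u*2+s*[2*k] : ∀ u s → (u + s * k) * 2 ≡ u * 2 + s * (2 * k)
  [u+s*k]*2≡u*2+s*[2*k] u s = solve (u ∷ s ∷ k ∷ [])

  ceilHalf-even : ∀ u → ceilHalf (u * 2) ≡ u
  ceilHalf-even u = trans (cong (_/ 2) (+-comm (u * 2) 1)) ([r+q*n]/n≡q {1} u 2 (s≤s (s≤s z≤n)))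

  ceilHalf-odd : ∀ u → ceilHalf (suc (u * 2)) ≡ suc u
  ceilHalf-odd u = trans (cong (_/ 2) (+-comm (suc (u * 2)) 1)) (m*n/n≡m (suc u) 2)

  μ-⌈/k⌉ : ∀ u s → μ (suc ((u + s * k) * 2)) ≡ suc (⌈ u /k⌉ + s)
  μ-⌈/k⌉ u s = trans (μ-odd (u + s * k)) (cong suc (⌈m+q*k/k⌉≡⌈m/k⌉+q u s))

  -- Σ_{y ≤ 2ks + t} μ(y) for 1 ≤ t ≤ 2k, with 1 + s moved to the left to avoid truncated subtraction.
  SumFormula : ℕ → ℕ → Set
  SumFormula s t = ∑< (suc (2 * k * s + t)) μ + 1 + s ≡ s * s * k + s * t + (2 * k * s + t) + ceilHalf t

  μ-step : ∀ s t → 1 ≤ t → t < 2 * k → μ (suc (2 * k * s + t)) + ceilHalf t ≡ suc s + ceilHalf (suc t)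
  μ-step s t 1≤t t<2k with evenOdd t
  ... | even (suc u) = begin
    μ (suc (2 * k * s + suc u * 2)) + ceilHalf (suc u * 2)
      ≡⟨ cong₂ _+_ (cong (μ ∘ suc) (2*k*s+u*2≡[u+s*k]*2 s (suc u))) (ceilHalf-even (suc u)) ⟩
    μ (suc ((suc u + s * k) * 2)) + suc u
      ≡⟨ cong (_+ suc u) (trans (μ-⌈/k⌉ (suc u) s) (cong (λ c → suc (c + s)) (⌈1+r/k⌉≡1 u<k))) ⟩
    suc (suc s) + suc u                   ≡⟨ +-suc (suc s) (suc u) ⟨
    suc s + suc (suc u)                   ≡⟨ cong (suc s +_) (ceilHalf-odd (suc u)) ⟨
    suc s + ceilHalf (suc (suc u * 2))    ∎
    where
    open ≡-Reasoning
    u<k : u < k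
    u<k = <-trans (n<1+n u) (1+x*2≤2*k⇒x<k t<2k)
  ... | odd u = begin
    μ (suc (2 * k * s + suc (u * 2))) + ceilHalf (suc (u * 2))
      ≡⟨ cong₂ _+_ (cong (μ ∘ suc) (2*k*s+1+u*2≡1+[u+s*k]*2 s u)) (ceilHalf-odd u) ⟩
    μ ((suc u + s * k) * 2) + suc u
      ≡⟨ cong (_+ suc u) (trans (μ-even (suc u + s * k)) (⌈1+r+q*k/k⌉≡1+q s u<k)) ⟩
    suc s + suc u                           ≡⟨ cong (suc s +_) (ceilHalf-even (suc u)) ⟨
    suc s + ceilHalf (suc (suc (u * 2)))    ∎
    where
    open ≡-Reasoning
    u<k : u < k
    u<k = 1+x*2≤2*k⇒x<k (<⇒≤ t<2k)

  sumFormula-base : SumFormula 0 1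
  sumFormula-base rewrite *-zeroʳ (2 * k) | ⌈0/k⌉≡0 = refl

  sumFormula-step : ∀ s t → 1 ≤ t → t < 2 * k → SumFormula s t → SumFormula s (suc t)
  sumFormula-step s t 1≤t t<2k IH = begin
    ∑< (suc (N + suc t)) μ + 1 + s                       ≡⟨ cong (λ n → ∑< (suc n) μ + 1 + s) (+-suc N t) ⟩
    ∑< (suc (N + t)) μ + μ (suc (N + t)) + 1 + s         ≡⟨ postpone (∑< (suc (N + t)) μ) (μ (suc (N + t))) s ⟩
    ∑< (suc (N + t)) μ + 1 + s + μ (suc (N + t))         ≡⟨ cong (_+ μ (suc (N + t))) IH ⟩
    R + ceilHalf t + μ (suc (N + t))                     ≡⟨ +-assoc R _ _ ⟩
    R + (ceilHalf t + μ (suc (N + t)))                   ≡⟨ cong (R +_) (trans (+-comm (ceilHalf t) _) (μ-step s t 1≤t t<2k)) ⟩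
    R + (suc s + ceilHalf (suc t))                       ≡⟨ regroup s k t N (ceilHalf (suc t)) ⟩
    s * s * k + s * suc t + (N + suc t) + ceilHalf (suc t) ∎
    where
    open ≡-Reasoning
    N = 2 * k * s
    R = s * s * k + s * t + (N + t)
    postpone : ∀ X m s → X + m + 1 + s ≡ X + 1 + s + m
    postpone = solve-∀
    regroup : ∀ s k t N c → s * s * k + s * t + (N + t) + (suc s + c) ≡ s * s * k + s * suc t + (N + suc t) + c
    regroup = solve-∀

  sumFormula-next : ∀ s → SumFormula s (2 * k) → SumFormula (suc s) 1
  sumFormula-next s IH = begin
    ∑< (suc (2 * k * suc s + 1)) μ + 1 + suc s                 ≡⟨ cong (λ n → ∑< (suc n) μ + 1 + suc s) (unfold k s) ⟩
    ∑< (suc N) μ + μ (suc N) + 1 + suc s                       ≡⟨ postpone (∑< (suc N) μ) (μ (suc N)) s ⟩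
    ∑< (suc N) μ + 1 + s + (μ (suc N) + 1)                     ≡⟨ cong₂ _+_ IH (cong (_+ 1) μ≡2+s) ⟩
    s * s * k + s * (2 * k) + N + ceilHalf (2 * k) + (suc (suc s) + 1)
      ≡⟨ cong (λ c → s * s * k + s * (2 * k) + N + c + (suc (suc s) + 1)) (trans (cong ceilHalf (*-comm 2 k)) (ceilHalf-even k)) ⟩
    s * s * k + s * (2 * k) + N + k + (suc (suc s) + 1)        ≡⟨ regroup s k ⟩
    suc s * suc s * k + suc s * 1 + (2 * k * suc s + 1) + 1    ∎
    where
    open ≡-Reasoning
    N = 2 * k * s + 2 * k
    unfold : ∀ k s → 2 * k * suc s + 1 ≡ suc (2 * k * s + 2 * k)
    unfold = solve-∀
    postpone : ∀ X m s → X + m + 1 + suc s ≡ X + 1 + s + (m + 1)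
    postpone = solve-∀
    regroup : ∀ s k → s * s * k + s * (2 * k) + (2 * k * s + 2 * k) + k + (suc (suc s) + 1)
                      ≡ suc s * suc s * k + suc s * 1 + (2 * k * suc s + 1) + 1
    regroup = solve-∀
    halve : ∀ s k → 2 * k * s + 2 * k ≡ (suc s * k) * 2
    halve = solve-∀
    μ≡2+s : μ (suc N) ≡ suc (suc s)
    μ≡2+s = begin
      μ (suc N)                           ≡⟨ cong (μ ∘ suc) (halve s k) ⟩
      μ (suc ((0 + suc s * k) * 2))       ≡⟨ μ-⌈/k⌉ 0 (suc s) ⟩
      suc (⌈ 0 /k⌉ + suc s)               ≡⟨ cong (λ c → suc (c + suc s)) ⌈0/k⌉≡0 ⟩
      suc (suc s)                         ∎

  sumFormula-from-1 : ∀ s t → SumFormula s 1 → 1 ≤ t → t ≤ 2 * k → SumFormula s t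
  sumFormula-from-1 s (suc zero)    F₁ _ _    = F₁
  sumFormula-from-1 s (suc (suc t)) F₁ _ t<2k =
    sumFormula-step s (suc t) (s≤s z≤n) t<2k (sumFormula-from-1 s (suc t) F₁ (s≤s z≤n) (<⇒≤ t<2k))

  sumFormula-1 : ∀ s → SumFormula s 1
  sumFormula-1 zero    = sumFormula-base
  sumFormula-1 (suc s) = sumFormula-next s (sumFormula-from-1 s (2 * k) (sumFormula-1 s) 1≤2k ≤-refl)
    where
    1≤2k : 1 ≤ 2 * k
    1≤2k = ≤-trans (s≤s z≤n) (*-monoʳ-≤ 2 (>-nonZero⁻¹ k))

  sumFormula : ∀ s t → 1 ≤ t → t ≤ 2 * k → SumFormula s t
  sumFormula s t = sumFormula-from-1 s t (sumFormula-1 s)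

module Generators (a h d k : ℕ) {{_ : NonZero a}} {{_ : NonZero k}} where

  open import Data.Nat
  open import Data.Nat.Properties
  open import Data.Nat.DivMod
  open import Data.Nat.Coprimality using (Coprime)
  open import Data.Product using (_,_)
  open import Data.Sum using (inj₁; inj₂)
  open import Data.List using (List; []; _∷_; map; upTo)
  open import Data.List.Membership.Propositional using (_∈_)
  open import Data.List.Membership.Propositional.Properties using (∈-map⁺; ∈-upTo⁺; ∈-upTo⁻)
  open import Data.List.Relation.Unary.Any using (here; there)
  open import Function using (_∘_)
  open import Relation.Binary.PropositionalEquality
  open import Data.Nat.Tactic.RingSolver
  open Representability
  open Parity
  open MinimalLength k
  open AperySet using (IsAperyEnumeration)
  open Residues using (*-%-injective; *-%-surjective)

  evenGenerators : List ℕ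
  evenGenerators = map (λ j → h * a + 2 * suc j * d) (upTo k)

  W : ℕ → ℕ
  W y = μ y * (h * a) + y * d

  ∈-evenGenerators : ∀ {j} → j < k → h * a + 2 * suc j * d ∈ evenGenerators
  ∈-evenGenerators j<k = ∈-map⁺ _ (∈-upTo⁺ j<k)

  representable-evenGenerators : ∀ e → Representable evenGenerators (⌈ e /k⌉ * (h * a) + e * 2 * d)
  representable-evenGenerators e with zero⊎1+r+q*k e
  ... | inj₁ refl = subst (λ z → Representable evenGenerators (z * (h * a) + 0 * 2 * d)) (sym ⌈0/k⌉≡0)
                          (representable-0 evenGenerators)
  ... | inj₂ (q , r , r<k , refl) =
    subst (λ z → Representable evenGenerators (z * (h * a) + (suc r + q * k) * 2 * d)) (sym (⌈1+r+q*k/k⌉≡1+q q r<k))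
      (subst (Representable evenGenerators) (sym (regroup q h a r k d))
        (representable-+* q largest (representable-+* 1 (∈-evenGenerators r<k) (representable-0 evenGenerators))))
    where
    largest : h * a + 2 * k * d ∈ evenGenerators
    largest = subst (λ j → h * a + 2 * j * d ∈ evenGenerators) (suc-pred k) (∈-evenGenerators pred-k<k)
    regroup : ∀ q h a r k d → suc q * (h * a) + (suc r + q * k) * 2 * d
                              ≡ q * (h * a + 2 * k * d) + (1 * (h * a + 2 * suc r * d) + 0)
    regroup = solve-∀

  representable-evenGenerators⇒ : ∀ js → (∀ {j} → j ∈ js → j < k) →
                                  ∀ {m} → Representable (map (λ j → h * a + 2 * suc j * d) js) m →
                        Σ ℕ λ p → Σ ℕ λ e → e ≤ p * k × m ≡ p * (h * a) + e * 2 * d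
  representable-evenGenerators⇒ []       _     refl = 0 , 0 , z≤n , refl
  representable-evenGenerators⇒ (j ∷ js) js<k (c , m , refl , r) with representable-evenGenerators⇒ js (js<k ∘ there) r
  ... | p , e , e≤pk , refl = c + p , c * suc j + e , bound , regroup c h a j d p e
    where
    bound : c * suc j + e ≤ (c + p) * k
    bound = subst (c * suc j + e ≤_) (sym (*-distribʳ-+ k c p))
                  (+-mono-≤ (*-monoʳ-≤ c (js<k (here refl))) e≤pk)
    regroup : ∀ c h a j d p e → c * (h * a + 2 * suc j * d) + (p * (h * a) + e * 2 * d)
                                ≡ (c + p) * (h * a) + (c * suc j + e) * 2 * d
    regroup = solve-∀

  W-representable : ∀ y c → Representable (vecA a h d k) (W y + c * a)
  W-representable y c = c , W y , +-comm (W y) (c * a) , W-by-non-a-generators y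
    where
    W-by-non-a-generators : ∀ y → Representable ((h * a + d) ∷ evenGenerators) (W y)
    W-by-non-a-generators y with evenOdd y
    ... | even x = 0 , _ , cong (_+ x * 2 * d) (cong (_* (h * a)) (μ-even x)) , representable-evenGenerators x
    ... | odd x  = 1 , _ , trans (cong (λ z → z * (h * a) + suc (x * 2) * d) (μ-odd x))
                                 (regroup ⌈ x /k⌉ h a x d) , representable-evenGenerators x
      where
      regroup : ∀ m h a x d → suc m * (h * a) + suc (x * 2) * d ≡ 1 * (h * a + d) + (m * (h * a) + x * 2 * d)
      regroup = solve-∀

  representable⇒W+* : ∀ {n} → Representable (vecA a h d k) n → Σ ℕ λ y → Σ ℕ λ c → n ≡ W y + c * a
  representable⇒W+* (c₀ , _ , refl , x , m , refl , r) with representable-evenGenerators⇒ (upTo k) ∈-upTo⁻ r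
  ... | p , e , e≤pk , refl = y , δ * h + c₀ , (begin
    c₀ * a + (x * (h * a + d) + (p * (h * a) + e * 2 * d))  ≡⟨ regroup₁ c₀ a x h d p e ⟩
    (x + p) * (h * a) + y * d + c₀ * a                      ≡⟨ cong (λ z → z * (h * a) + y * d + c₀ * a) x+p≡μy+δ ⟩
    (μ y + δ) * (h * a) + y * d + c₀ * a                    ≡⟨ regroup₂ (μ y) δ h a (y * d) c₀ ⟩
    W y + (δ * h + c₀) * a                                  ∎)
    where
    open ≡-Reasoning
    y = x + e * 2
    μy≤x+p : μ y ≤ x + p
    μy≤x+p = ≤-trans (μ-+ x (e * 2)) (+-monoʳ-≤ x (subst (_≤ p) (sym (μ-even e))
               (subst (⌈ e /k⌉ ≤_) (⌈q*k/k⌉≡q p) (⌈/k⌉-mono e≤pk))))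
    δ = x + p ∸ μ y
    x+p≡μy+δ : x + p ≡ μ y + δ
    x+p≡μy+δ = sym (m+[n∸m]≡n μy≤x+p)
    regroup₁ : ∀ c₀ a x h d p e → c₀ * a + (x * (h * a + d) + (p * (h * a) + e * 2 * d))
                                  ≡ (x + p) * (h * a) + (x + e * 2) * d + c₀ * a
    regroup₁ = solve-∀
    regroup₂ : ∀ M δ h a z c₀ → (M + δ) * (h * a) + z + c₀ * a ≡ M * (h * a) + z + (δ * h + c₀) * a
    regroup₂ = solve-∀

  μ-≤-+*a : 2 * k < a → ∀ y q → μ y ≤ μ (y + q * a)
  μ-≤-+*a _    y zero    = ≤-reflexive (cong μ (sym (+-identityʳ y)))
  μ-≤-+*a 2k<a y (suc q) = μ-mono-+k*2 (+-monoʳ-≤ y (≤-trans k*2≤a (m≤m+n a (q * a))))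
    where
    k*2≤a : k * 2 ≤ a
    k*2≤a = subst (_≤ a) (*-comm 2 k) (<⇒≤ 2k<a)

  W-+*a : 2 * k < a → ∀ y q → Σ ℕ λ c → W (y + q * a) ≡ W y + c * a
  W-+*a 2k<a y q = δ * h + q * d , (begin
    μ (y + q * a) * (h * a) + (y + q * a) * d  ≡⟨ cong (λ z → z * (h * a) + (y + q * a) * d) μ≡μ+δ ⟩
    (μ y + δ) * (h * a) + (y + q * a) * d      ≡⟨ regroup (μ y) δ h a y q d ⟩
    μ y * (h * a) + y * d + (δ * h + q * d) * a ∎)
    where
    open ≡-Reasoning
    δ = μ (y + q * a) ∸ μ y
    μ≡μ+δ : μ (y + q * a) ≡ μ y + δ
    μ≡μ+δ = sym (m+[n∸m]≡n (μ-≤-+*a 2k<a y q))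
    regroup : ∀ M δ h a y q d → (M + δ) * (h * a) + (y + q * a) * d ≡ M * (h * a) + y * d + (δ * h + q * d) * a
    regroup = solve-∀

  representable⇒W : 2 * k < a → ∀ {n} → Representable (vecA a h d k) n →
                    Σ ℕ λ y → Σ ℕ λ c → y < a × n ≡ W y + c * a
  representable⇒W 2k<a r with representable⇒W+* r
  ... | y , c , refl with W-+*a 2k<a (y % a) (y / a)
  ... | c′ , W≡W+c′a = y % a , c′ + c , m%n<n y a , (begin
    W y + c * a                   ≡⟨ cong (λ z → W z + c * a) (m≡m%n+[m/n]*n y a) ⟩
    W (y % a + y / a * a) + c * a ≡⟨ cong (_+ c * a) W≡W+c′a ⟩
    W (y % a) + c′ * a + c * a    ≡⟨ +-assoc (W (y % a)) _ _ ⟩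
    W (y % a) + (c′ * a + c * a)  ≡⟨ cong (W (y % a) +_) (*-distribʳ-+ a c′ c) ⟨
    W (y % a) + (c′ + c) * a      ∎)
    where open ≡-Reasoning

  W%a≡yd%a : ∀ y → W y % a ≡ (y * d) % a
  W%a≡yd%a y = trans (cong (_% a) W≡yd+μha) ([m+kn]%n≡m%n (y * d) (μ y * h) a)
    where
    W≡yd+μha : W y ≡ y * d + μ y * h * a
    W≡yd+μha = trans (+-comm (μ y * (h * a)) (y * d)) (cong (y * d +_) (sym (*-assoc (μ y) h a)))

  isAperyEnumeration : Coprime a d → 2 * k < a → IsAperyEnumeration (vecA a h d k) a W
  isAperyEnumeration a⊥d 2k<a = record
    { representable      = λ y c _ → W-representable y c
    ; minimal            = representable⇒W 2k<a
    ; residue-injective  = λ {y} {y′} y<a y′<a W≡W′ → *-%-injective a⊥d y<a y′<a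
                             (trans (sym (W%a≡yd%a y)) (trans W≡W′ (W%a≡yd%a y′)))
    ; residue-surjective = surjective
    }
    where
    surjective : ∀ m → Σ ℕ λ y → y < a × W y % a ≡ m % a
    surjective m with *-%-surjective a⊥d m
    ... | y , y<a , yd≡m = y , y<a , trans (W%a≡yd%a y) yd≡m

module FrobeniusNumber (a h d k : ℕ) {{_ : NonZero a}} {{_ : NonZero k}}
                       (0<h : 0 < h) (a⊥d : Coprime a d) (2k<a : 2 Data.Nat.* k < a) where

  open import Data.Nat
  open import Data.Nat.Properties
  open import Data.Nat.Divisibility using (_∣_; divides)
  open import Data.Product using (_,_; proj₁; proj₂)
  open import Data.Sum using (inj₁; inj₂)
  open import Relation.Nullary using (yes; no; contradiction)
  open import Relation.Binary.PropositionalEquality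
  open Arithmetic
  open Parity
  open MinimalLength k
  open Generators a h d k
  open AperySet

  W-mono : ∀ {y z} → y ≤ z → μ y ≤ μ z → W y ≤ W z
  W-mono y≤z μy≤μz = +-mono-≤ (*-monoˡ-≤ (h * a) μy≤μz) (*-monoˡ-≤ d y≤z)

  a≤W : ∀ {y} → 0 < μ y → a ≤ W y
  a≤W {y} 0<μy = ≤-trans (m≤n*m a h {{>-nonZero 0<h}})
                   (≤-trans (m≤n*m (h * a) (μ y) {{>-nonZero 0<μy}}) (m≤m+n (μ y * (h * a)) (y * d)))

  W∸a+a≡ : ∀ {y n} → 0 < μ y → μ y ≡ n → W y ∸ a + a ≡ n * (h * a) + y * d
  W∸a+a≡ {y} 0<μy refl = m∸n+n≡m (a≤W {y} 0<μy)

  a∸1<a : a ∸ 1 < a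
  a∸1<a = ∸-monoʳ-< {a} z<s (>-nonZero⁻¹ a)

  isFrobenius-W : ∀ {z} x → z ≡ suc (x * 2) → z < a → a ≤ 2 + z →
                  IsFrobenius (vecA a h d k) (W (a ∸ 1) ⊔ W z ∸ a)
  isFrobenius-W {z} x refl z<a a≤z+2 = isFrobenius (isAperyEnumeration a⊥d 2k<a) attained bounded a≤M
    where
    attained : Σ ℕ λ y → y < a × W y ≡ W (a ∸ 1) ⊔ W z
    attained with ⊔-sel (W (a ∸ 1)) (W z)
    ... | inj₁ M≡W₁ = a ∸ 1 , a∸1<a , sym M≡W₁
    ... | inj₂ M≡W₂ = z , z<a , sym M≡W₂
    bounded : ∀ y → y < a → W y ≤ W (a ∸ 1) ⊔ W z
    bounded y y<a with y ≤? z
    ... | yes y≤z = ≤-trans (W-mono y≤z (μ-≤-odd x y≤z)) (m≤n⊔m (W (a ∸ 1)) (W z))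
    ... | no  y≰z = ≤-trans (≤-reflexive (cong W y≡a∸1)) (m≤m⊔n (W (a ∸ 1)) (W z))
      where
      y≡a∸1 : y ≡ a ∸ 1
      y≡a∸1 = ≤-antisym (∸-monoˡ-≤ 1 y<a) (≤-trans (∸-monoˡ-≤ 1 a≤z+2) (≰⇒> y≰z))
    a≤M : a ≤ W (a ∸ 1) ⊔ W z
    a≤M = ≤-trans (a≤W {z} (subst (0 <_) (sym (μ-odd x)) z<s)) (m≤n⊔m (W (a ∸ 1)) (W z))

  2<a : 2 < a
  2<a = 2*k<a⇒2<a 2k<a

  1+[a∸1]≡a : suc (a ∸ 1) ≡ a
  1+[a∸1]≡a = m+[n∸m]≡n (>-nonZero⁻¹ a)

  a∸1≡1+[a∸2] : a ∸ 1 ≡ suc (a ∸ 2)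
  a∸1≡1+[a∸2] = m∸n≡1+m∸[1+n] {a} {1} (<-trans (n<1+n 1) 2<a)

  fdiv-2k : ∀ {m r} s → r < 2 * k → m ≡ r + s * (2 * k) → fdiv m (2 * k) ≡ s
  fdiv-2k {m} s r<2k refl = trans (fdiv≡/ m (2 * k)) ([r+q*n]/n≡q s (2 * k) r<2k)

  ⌈u/k⌉-cases : ∀ {u} → u < k → (suc (u * 2) ≢ 1 → ⌈ u /k⌉ ≡ 1) × (suc (u * 2) ≡ 1 → ⌈ u /k⌉ ≡ 0)
  ⌈u/k⌉-cases {zero}  _     = (λ t≢1 → contradiction refl t≢1) , (λ _ → ⌈0/k⌉≡0)
  ⌈u/k⌉-cases {suc u} 1+u<k = (λ _ → ⌈1+r/k⌉≡1 (<-trans (n<1+n u) 1+u<k)) , (λ ())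

  frobenius-a-even : 2 ∣ a → ∀ s t → a ∸ 1 ≡ 2 * k * s + t → t ≤ 2 * k →
                     Σ ℕ λ g → IsFrobenius (vecA a h d k) g
                       × (t ≢ 1 → g + a ≡ (fdiv (a ∸ 2) (2 * k) + 2) * (h * a) + (a ∸ 1) * d)
                       × (t ≡ 1 → g + a ≡ (fdiv (a ∸ 2) (2 * k) + 1) * (h * a) + (a ∸ 1) * d)
  frobenius-a-even 2∣a s t a∸1≡ t≤2k with evenOdd t
  ... | even u = contradiction (subst (2 ∣_) a≡odd 2∣a) (2∤1+x*2 (u + s * k))
    where
    a≡odd : a ≡ suc ((u + s * k) * 2)
    a≡odd = trans (sym 1+[a∸1]≡a) (cong suc (trans a∸1≡ (2*k*s+u*2≡[u+s*k]*2 s u)))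
  ... | odd u = W (a ∸ 1) ∸ a
              , subst (IsFrobenius (vecA a h d k)) (cong (_∸ a) (⊔-idem (W (a ∸ 1))))
                  (isFrobenius-W x a∸1≡1+x*2 a∸1<a (≤-trans (≤-reflexive (sym 1+[a∸1]≡a)) (n≤1+n _)))
              , (λ t≢1 → g+a≡ (proj₁ (⌈u/k⌉-cases u<k) t≢1))
              , (λ t≡1 → g+a≡ (proj₂ (⌈u/k⌉-cases u<k) t≡1))
    where
    x = u + s * k
    u<k : u < k
    u<k = 1+x*2≤2*k⇒x<k t≤2k
    a∸1≡1+x*2 : a ∸ 1 ≡ suc (x * 2)
    a∸1≡1+x*2 = trans a∸1≡ (2*k*s+1+u*2≡1+[u+s*k]*2 s u)
    σ≡s : fdiv (a ∸ 2) (2 * k) ≡ s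
    σ≡s = fdiv-2k s t≤2k (trans (suc-injective (trans (sym a∸1≡1+[a∸2]) a∸1≡1+x*2)) ([u+s*k]*2≡u*2+s*[2*k] u s))
    g+a≡ : ∀ {c} → ⌈ u /k⌉ ≡ c → W (a ∸ 1) ∸ a + a ≡ (fdiv (a ∸ 2) (2 * k) + suc c) * (h * a) + (a ∸ 1) * d
    g+a≡ {c} ⌈u/k⌉≡c = W∸a+a≡ {a ∸ 1} (subst (0 <_) (sym μ≡) z<s)
      (trans μ≡ (trans (cong (λ c → suc (c + s)) ⌈u/k⌉≡c) (trans (+-comm (suc c) s) (cong (_+ suc c) (sym σ≡s)))))
      where
      μ≡ : μ (a ∸ 1) ≡ suc (⌈ u /k⌉ + s)
      μ≡ = trans (cong μ a∸1≡1+x*2) (μ-⌈/k⌉ u s)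

  frobenius-a-odd : ¬ 2 ∣ a → ∀ s t → a ∸ 2 ≡ 2 * k * s + t → t ≤ 2 * k →
                    Σ ℕ λ g → IsFrobenius (vecA a h d k) g
                      × (t ≢ 1 → Σ ℕ λ g₁ → Σ ℕ λ g₂ → g ≡ g₁ ⊔ g₂
                                   × g₁ + a ≡ (fdiv (a ∸ 2) (2 * k) + 1) * (h * a) + (a ∸ 1) * d
                                   × g₂ + a ≡ (fdiv (a ∸ 3) (2 * k) + 2) * (h * a) + (a ∸ 2) * d)
                      × (t ≡ 1 → g + a ≡ (fdiv (a ∸ 2) (2 * k) + 1) * (h * a) + (a ∸ 1) * d)
  frobenius-a-odd 2∤a s t a∸2≡ t≤2k with evenOdd t
  ... | even u = contradiction (divides (suc (u + s * k)) a≡even) 2∤a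
    where
    a≡even : a ≡ suc (u + s * k) * 2
    a≡even = trans (sym (m+[n∸m]≡n (<⇒≤ 2<a))) (cong (2 +_) (trans a∸2≡ (2*k*s+u*2≡[u+s*k]*2 s u)))
  ... | odd u = W (a ∸ 1) ⊔ W (a ∸ 2) ∸ a
              , isFrobenius-W x a∸2≡1+x*2 (≤-<-trans (n≤1+n _) (subst (_< a) a∸1≡1+[a∸2] a∸1<a))
                              (≤-reflexive (sym (m+[n∸m]≡n (<⇒≤ 2<a))))
              , (λ t≢1 → W (a ∸ 1) ∸ a , W (a ∸ 2) ∸ a , ∸-distribʳ-⊔ a (W (a ∸ 1)) (W (a ∸ 2))
                       , g₁+a≡ , g₂+a≡ t≢1)
              , (λ t≡1 → trans (cong (λ z → z ∸ a + a) (m≥n⇒m⊔n≡m (W₂≤W₁ t≡1))) g₁+a≡)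
    where
    x = u + s * k
    u<k : u < k
    u<k = 1+x*2≤2*k⇒x<k t≤2k
    a∸2≡1+x*2 : a ∸ 2 ≡ suc (x * 2)
    a∸2≡1+x*2 = trans a∸2≡ (2*k*s+1+u*2≡1+[u+s*k]*2 s u)
    1+u*2<2k : suc (u * 2) < 2 * k
    1+u*2<2k = subst (suc u * 2 ≤_) (*-comm k 2) (*-monoˡ-≤ 2 u<k)
    σ≡s : fdiv (a ∸ 2) (2 * k) ≡ s
    σ≡s = fdiv-2k s 1+u*2<2k (trans a∸2≡1+x*2 (cong suc ([u+s*k]*2≡u*2+s*[2*k] u s)))
    σ′≡s : fdiv (a ∸ 3) (2 * k) ≡ s
    σ′≡s = fdiv-2k s (<-trans (n<1+n (u * 2)) 1+u*2<2k)
             (trans (suc-injective (trans (sym (m∸n≡1+m∸[1+n] {a} {2} 2<a)) a∸2≡1+x*2)) ([u+s*k]*2≡u*2+s*[2*k] u s))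
    μ₁≡ : μ (a ∸ 1) ≡ suc s
    μ₁≡ = trans (cong μ (trans a∸1≡1+[a∸2] (cong suc a∸2≡1+x*2))) (trans (μ-even (suc x)) (⌈1+r+q*k/k⌉≡1+q s u<k))
    μ₂≡ : μ (a ∸ 2) ≡ suc (⌈ u /k⌉ + s)
    μ₂≡ = trans (cong μ a∸2≡1+x*2) (μ-⌈/k⌉ u s)
    g₁+a≡ : W (a ∸ 1) ∸ a + a ≡ (fdiv (a ∸ 2) (2 * k) + 1) * (h * a) + (a ∸ 1) * d
    g₁+a≡ = W∸a+a≡ {a ∸ 1} (subst (0 <_) (sym μ₁≡) z<s) (trans μ₁≡ (trans (+-comm 1 s) (cong (_+ 1) (sym σ≡s))))
    g₂+a≡ : suc (u * 2) ≢ 1 → W (a ∸ 2) ∸ a + a ≡ (fdiv (a ∸ 3) (2 * k) + 2) * (h * a) + (a ∸ 2) * d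
    g₂+a≡ t≢1 = W∸a+a≡ {a ∸ 2} (subst (0 <_) (sym μ₂≡) z<s)
      (trans μ₂≡ (trans (cong (λ c → suc (c + s)) (proj₁ (⌈u/k⌉-cases u<k) t≢1))
                        (trans (+-comm 2 s) (cong (_+ 2) (sym σ′≡s)))))
    W₂≤W₁ : suc (u * 2) ≡ 1 → W (a ∸ 2) ≤ W (a ∸ 1)
    W₂≤W₁ t≡1 = W-mono (subst (a ∸ 2 ≤_) (sym a∸1≡1+[a∸2]) (n≤1+n (a ∸ 2)))
      (≤-reflexive (trans μ₂≡ (trans (cong (λ c → suc (c + s)) (proj₂ (⌈u/k⌉-cases u<k) t≡1)) (sym μ₁≡))))

module SylvesterNumber (a h d k : ℕ) {{_ : NonZero a}} {{_ : NonZero k}}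
                       (a⊥d : Coprime a d) (2k<a : 2 Data.Nat.* k < a) where

  open import Data.Nat
  open import Data.Nat.Properties
  open import Data.Nat.DivMod
  open import Data.Nat.Divisibility using (divides)
  open import Relation.Binary.PropositionalEquality
  open import Data.Nat.Tactic.RingSolver
  open Sums
  open Arithmetic
  open MinimalLength k
  open Generators a h d k

  W/a≡hμ+yd/a : ∀ y → W y / a ≡ h * μ y + y * d / a
  W/a≡hμ+yd/a y = begin
    (μ y * (h * a) + y * d) / a    ≡⟨ cong (_/ a) (swap (μ y) h a (y * d)) ⟩
    (y * d + h * μ y * a) / a      ≡⟨ +-distrib-/-∣ʳ (y * d) (divides (h * μ y) refl) ⟩
    y * d / a + h * μ y * a / a    ≡⟨ cong (y * d / a +_) (m*n/n≡m (h * μ y) a) ⟩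
    y * d / a + h * μ y            ≡⟨ +-comm (y * d / a) (h * μ y) ⟩
    h * μ y + y * d / a            ∎
    where
    open ≡-Reasoning
    swap : ∀ m h a z → m * (h * a) + z ≡ z + h * m * a
    swap = solve-∀

  s₀ t₀ : ℕ
  s₀ = fdiv (a ∸ 2) (2 * k)
  t₀ = a ∸ 1 ∸ 2 * k * s₀

  ∑<μ : ∑< a μ + 1 + s₀ ≡ s₀ * s₀ * k + s₀ * t₀ + (a ∸ 1) + ceilHalf t₀
  ∑<μ = begin
    ∑< a μ + 1 + s₀                                          ≡⟨ cong (λ n → ∑< n μ + 1 + s₀) a≡ ⟨
    ∑< (suc (2 * k * s₀ + suc r)) μ + 1 + s₀
      ≡⟨ sumFormula s₀ (suc r) (s≤s z≤n) (m%n<n (a ∸ 2) (2 * k)) ⟩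
    s₀ * s₀ * k + s₀ * suc r + (2 * k * s₀ + suc r) + ceilHalf (suc r)
      ≡⟨ cong₂ (λ t n → s₀ * s₀ * k + s₀ * t + n + ceilHalf t) (sym t₀≡1+r) (sym a∸1≡) ⟩
    s₀ * s₀ * k + s₀ * t₀ + (a ∸ 1) + ceilHalf t₀            ∎
    where
    open ≡-Reasoning
    r = (a ∸ 2) % (2 * k)
    a∸1≡ : a ∸ 1 ≡ 2 * k * s₀ + suc r
    a∸1≡ = begin
      a ∸ 1                          ≡⟨ m∸n≡1+m∸[1+n] {a} {1} (<-trans (n<1+n 1) (2*k<a⇒2<a 2k<a)) ⟩
      suc (a ∸ 2)                    ≡⟨ cong suc (m≡m%n+[m/n]*n (a ∸ 2) (2 * k)) ⟩
      suc (r + (a ∸ 2) / (2 * k) * (2 * k)) ≡⟨ cong (λ q → suc (r + q * (2 * k))) (fdiv≡/ (a ∸ 2) (2 * k)) ⟨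
      suc (r + s₀ * (2 * k))         ≡⟨ cong suc (+-comm r _) ⟩
      suc (s₀ * (2 * k) + r)         ≡⟨ +-suc _ r ⟨
      s₀ * (2 * k) + suc r           ≡⟨ cong (_+ suc r) (*-comm s₀ (2 * k)) ⟩
      2 * k * s₀ + suc r             ∎
    a≡ : suc (2 * k * s₀ + suc r) ≡ a
    a≡ = trans (cong suc (sym a∸1≡)) (m+[n∸m]≡n (>-nonZero⁻¹ a))
    t₀≡1+r : t₀ ≡ suc r
    t₀≡1+r = trans (cong (_∸ 2 * k * s₀) a∸1≡) (m+n∸m≡n (2 * k * s₀) (suc r))

  sylvester : IsSylvester (vecA a h d k) (h * ∑< a μ + ∑< a (λ y → y * d / a))
  sylvester = subst (IsSylvester (vecA a h d k)) count
                (AperySet.isSylvester (isAperyEnumeration a⊥d 2k<a))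
    where
    count : ∑< a (λ y → W y / a) ≡ h * ∑< a μ + ∑< a (λ y → y * d / a)
    count = begin
      ∑< a (λ y → W y / a)                          ≡⟨ ∑<-cong a (λ y _ → W/a≡hμ+yd/a y) ⟩
      ∑< a (λ y → h * μ y + y * d / a)              ≡⟨ ∑<-distrib-+ a (λ y → h * μ y) (λ y → y * d / a) ⟩
      ∑< a (λ y → h * μ y) + ∑< a (λ y → y * d / a) ≡⟨ cong (_+ ∑< a (λ y → y * d / a)) (∑<-*ˡ h a μ) ⟩
      h * ∑< a μ + ∑< a (λ y → y * d / a)           ∎
      where open ≡-Reasoning

module IntegerForms where

  open import Data.Nat as ℕ using (ℕ)
  open import Data.Integer using (ℤ; +_; _+_; _*_; _-_)
  open import Data.Integer.Properties using (pos-*; m-n≡m⊖n; ⊖-≥; *-comm)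
  open import Relation.Binary.PropositionalEquality
  open import Data.Integer.Tactic.RingSolver

  +-∸ : ∀ {m n} → n ℕ.≤ m → + (m ℕ.∸ n) ≡ + m - + n
  +-∸ {m} {n} n≤m = sym (trans (m-n≡m⊖n m n) (⊖-≥ n≤m))

  sylvester-toℤ : ∀ {a d h k M S s t C} → 1 ℕ.≤ a → 1 ℕ.≤ d → 2 ℕ.* S ≡ (a ℕ.∸ 1) ℕ.* (d ℕ.∸ 1) →
                  M ℕ.+ 1 ℕ.+ s ≡ s ℕ.* s ℕ.* k ℕ.+ s ℕ.* t ℕ.+ (a ℕ.∸ 1) ℕ.+ C →
                  + 2 * + (h ℕ.* M ℕ.+ S) ≡ + 2 * + h * (+ s * + s * + k + + s * + t - + s - + 1)
                                            + (+ a - + 1) * (+ 2 * + h + + d - + 1) + + 2 * + h * + C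
  sylvester-toℤ {a} {d} {h} {k} {M} {S} {s} {t} {C} 1≤a 1≤d 2S≡ M+1+s≡ = begin
    + 2 * (+ (h ℕ.* M) + + S)                                   ≡⟨ cong (λ z → + 2 * (z + + S)) (pos-* h M) ⟩
    + 2 * (+ h * + M + + S)                                     ≡⟨ isolate (+ h) (+ M) (+ S) (+ s) ⟩
    + 2 * + h * (+ M + + 1 + + s) - + 2 * + h * (+ 1 + + s) + + 2 * + S
      ≡⟨ cong₂ (λ u v → + 2 * + h * u - + 2 * + h * (+ 1 + + s) + v) M+1+s≡ℤ 2S≡ℤ ⟩
    + 2 * + h * (+ s * + s * + k + + s * + t + (+ a - + 1) + + C) - + 2 * + h * (+ 1 + + s) + (+ a - + 1) * (+ d - + 1)
      ≡⟨ regroup (+ h) (+ s) (+ k) (+ t) (+ a) (+ d) (+ C) ⟩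
    + 2 * + h * (+ s * + s * + k + + s * + t - + s - + 1) + (+ a - + 1) * (+ 2 * + h + + d - + 1) + + 2 * + h * + C ∎
    where
    open ≡-Reasoning
    isolate : ∀ h M S s → + 2 * (h * M + S) ≡ + 2 * h * (M + + 1 + s) - + 2 * h * (+ 1 + s) + + 2 * S
    isolate = solve-∀
    regroup : ∀ h s k t a d C →
              + 2 * h * (s * s * k + s * t + (a - + 1) + C) - + 2 * h * (+ 1 + s) + (a - + 1) * (d - + 1)
              ≡ + 2 * h * (s * s * k + s * t - s - + 1) + (a - + 1) * (+ 2 * h + d - + 1) + + 2 * h * C
    regroup = solve-∀
    2S≡ℤ : + 2 * + S ≡ (+ a - + 1) * (+ d - + 1)
    2S≡ℤ = begin
      + 2 * + S                          ≡⟨ pos-* 2 S ⟨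
      + (2 ℕ.* S)                        ≡⟨ cong +_ 2S≡ ⟩
      + ((a ℕ.∸ 1) ℕ.* (d ℕ.∸ 1))        ≡⟨ pos-* (a ℕ.∸ 1) (d ℕ.∸ 1) ⟩
      + (a ℕ.∸ 1) * + (d ℕ.∸ 1)          ≡⟨ cong₂ _*_ (+-∸ 1≤a) (+-∸ 1≤d) ⟩
      (+ a - + 1) * (+ d - + 1)          ∎
    M+1+s≡ℤ : + M + + 1 + + s ≡ + s * + s * + k + + s * + t + (+ a - + 1) + + C
    M+1+s≡ℤ = begin
      + (M ℕ.+ 1 ℕ.+ s)                                            ≡⟨ cong +_ M+1+s≡ ⟩
      + (s ℕ.* s ℕ.* k) + + (s ℕ.* t) + + (a ℕ.∸ 1) + + C
        ≡⟨ cong₂ (λ u v → u + v + + (a ℕ.∸ 1) + + C) (trans (pos-* (s ℕ.* s) k) (cong (_* + k) (pos-* s s))) (pos-* s t) ⟩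
      + s * + s * + k + + s * + t + + (a ℕ.∸ 1) + + C
        ≡⟨ cong (λ z → + s * + s * + k + + s * + t + z + + C) (+-∸ 1≤a) ⟩
      + s * + s * + k + + s * + t + (+ a - + 1) + + C             ∎

  frobenius-toℤ : ∀ {g a d j} h σ c → j ℕ.≤ a → g ℕ.+ a ≡ (σ ℕ.+ c) ℕ.* (h ℕ.* a) ℕ.+ (a ℕ.∸ j) ℕ.* d →
                  + g ≡ + h * + a * (+ σ + + c) + (+ a - + j) * + d - + a
  frobenius-toℤ {g} {a} {d} {j} h σ c j≤a g+a≡ = begin
    + g                                                         ≡⟨ cancel (+ g) (+ a) ⟩
    + (g ℕ.+ a) - + a                                           ≡⟨ cong (λ z → + z - + a) g+a≡ ⟩
    + ((σ ℕ.+ c) ℕ.* (h ℕ.* a)) + + ((a ℕ.∸ j) ℕ.* d) - + a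
      ≡⟨ cong₂ (λ u v → u + v - + a) (trans (pos-* (σ ℕ.+ c) (h ℕ.* a)) (cong (+ (σ ℕ.+ c) *_) (pos-* h a)))
                                      (trans (pos-* (a ℕ.∸ j) d) (cong (_* + d) (+-∸ j≤a))) ⟩
    (+ σ + + c) * (+ h * + a) + (+ a - + j) * + d - + a
      ≡⟨ cong (λ z → z + (+ a - + j) * + d - + a) (*-comm (+ σ + + c) _) ⟩
    + h * + a * (+ σ + + c) + (+ a - + j) * + d - + a           ∎
    where
    open ≡-Reasoning
    cancel : ∀ g a → g ≡ g + a - a
    cancel = solve-∀

open import Data.Integer using (ℤ; +_; _+_; _*_; _-_; _⊔_)
open import Data.Product using (_,_)
open import Relation.Binary.PropositionalEquality using (trans; cong; cong₂)
open import Data.Nat.Properties using (<⇒≤; <-trans; ≤-<-trans; n<1+n; ∸-monoʳ-<)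
open import Data.Nat.Coprimality using (gcd≡1⇒coprime)
open IntegerForms
open Residues using (∑⌊yd/a⌋)

theorem4p4 : (a h d k : ℕ) → 0 < h → 0 < d → gcd a d ≡ 1 → 2 < a → 1 ≤ k → (2 Data.Nat.* k) ≤ a ∸ 1 →
    ((2 ∣ a) → (s t : ℕ) → a ∸ 1 ≡ 2 Data.Nat.* k Data.Nat.* s Data.Nat.+ t → 1 ≤ t → t ≤ 2 Data.Nat.* k →
      Σ ℕ λ g → IsFrobenius (vecA a h d k) g
        × (t ≢ 1 → + g ≡ + h * + a * (+ fdiv (a ∸ 2) (2 Data.Nat.* k) + + 2) + (+ a - + 1) * + d - + a)
        × (t ≡ 1 → + g ≡ + h * + a * (+ fdiv (a ∸ 2) (2 Data.Nat.* k) + + 1) + (+ a - + 1) * + d - + a))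
    × ((¬ (2 ∣ a)) → (s t : ℕ) → a ∸ 2 ≡ 2 Data.Nat.* k Data.Nat.* s Data.Nat.+ t → 1 ≤ t → t ≤ 2 Data.Nat.* k →
      Σ ℕ λ g → IsFrobenius (vecA a h d k) g
        × (t ≢ 1 → + g ≡ ((+ h * + a * (+ fdiv (a ∸ 2) (2 Data.Nat.* k) + + 1) + (+ a - + 1) * + d - + a)
                          ⊔ (+ h * + a * (+ fdiv (a ∸ 3) (2 Data.Nat.* k) + + 2) + (+ a - + 2) * + d - + a)))
        × (t ≡ 1 → + g ≡ + h * + a * (+ fdiv (a ∸ 2) (2 Data.Nat.* k) + + 1) + (+ a - + 1) * + d - + a))
    × (Σ ℕ λ N → IsSylvester (vecA a h d k) N
        × (+ 2 * + N ≡
             + 2 * + h * (+ (fdiv (a ∸ 2) (2 Data.Nat.* k)) * + (fdiv (a ∸ 2) (2 Data.Nat.* k)) * + k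
                          + + (fdiv (a ∸ 2) (2 Data.Nat.* k)) * + (a ∸ 1 ∸ 2 Data.Nat.* k Data.Nat.* fdiv (a ∸ 2) (2 Data.Nat.* k))
                          - + (fdiv (a ∸ 2) (2 Data.Nat.* k)) - + 1)
             + (+ a - + 1) * (+ 2 * + h + + d - + 1)
             + + 2 * + h * + ceilHalf (a ∸ 1 ∸ 2 Data.Nat.* k Data.Nat.* fdiv (a ∸ 2) (2 Data.Nat.* k))))
theorem4p4 a h d k 0<h 0<d gcd≡1 2<a 1≤k 2k≤a∸1 =
    (λ 2∣a s t a∸1≡ _ t≤2k →
       let g , frob , t≢1⇒ , t≡1⇒ = frobenius-a-even 2∣a s t a∸1≡ t≤2k
       in  g , frob , (λ t≢1 → frobenius-toℤ h σ₂ 2 1≤a (t≢1⇒ t≢1))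
                    , (λ t≡1 → frobenius-toℤ h σ₂ 1 1≤a (t≡1⇒ t≡1)))
  , (λ 2∤a s t a∸2≡ _ t≤2k →
       let g , frob , t≢1⇒ , t≡1⇒ = frobenius-a-odd 2∤a s t a∸2≡ t≤2k
       in  g , frob
         , (λ t≢1 → let g₁ , g₂ , g≡g₁⊔g₂ , g₁+a≡ , g₂+a≡ = t≢1⇒ t≢1
                    in  trans (cong +_ g≡g₁⊔g₂)
                              (cong₂ _⊔_ (frobenius-toℤ h σ₂ 1 1≤a g₁+a≡) (frobenius-toℤ h σ₃ 2 2≤a g₂+a≡)))
         , (λ t≡1 → frobenius-toℤ h σ₂ 1 1≤a (t≡1⇒ t≡1)))
  , (_ , sylvester , sylvester-toℤ {h = h} {k = k} {s = s₀} {t = t₀} 1≤a 0<d (∑⌊yd/a⌋ a⊥d) ∑<μ)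
  where
  σ₂ σ₃ : ℕ
  σ₂ = fdiv (a ∸ 2) (2 Data.Nat.* k)
  σ₃ = fdiv (a ∸ 3) (2 Data.Nat.* k)
  2≤a : 2 ≤ a
  2≤a = <⇒≤ 2<a
  1≤a : 1 ≤ a
  1≤a = <⇒≤ (<-trans (n<1+n 1) 2<a)
  instance
    a≢0 : NonZero a
    a≢0 = >-nonZero 1≤a
    k≢0 : NonZero k
    k≢0 = >-nonZero 1≤k
  a⊥d : Coprime a d
  a⊥d = gcd≡1⇒coprime gcd≡1
  2k<a : 2 Data.Nat.* k < a
  2k<a = ≤-<-trans 2k≤a∸1 (∸-monoʳ-< {a} (n<1+n 0) 1≤a)
  open FrobeniusNumber a h d k 0<h a⊥d 2k<a
  open SylvesterNumber a h d k a⊥d 2k<a
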